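{- Let $p=(123,\{2\},\emptyset)$ and $r=(123,\emptyset,\{2\})$. Then for every $n\ge 0$, \[|\mathrm{Av}_n(p,r)|=\sum_{k=0}^{n}\binom{\binom{k+1}{2}+n-k-1}{n-k}.\]
   Context: For $n\ge 0$, $\mathcal{S}_n$ is the set of permutations of $[n]=\{1,\dots,n\}$, written as words $\pi=\pi(1)\pi(2)\cdots\pi(n)$. Two words of distinct integers of the same length are order-isomorphic if their entries appear in the same relative order. A pattern of length 3 is a triple $(\sigma,X,Y)$ with $\sigma\in\mathcal{S}_3$ and $X,Y\subseteq\{1,2\}$. A permutation $\pi\in\mathcal{S}_n$ contains $(\sigma,X,Y)$ if there are indices $i_1<i_2<i_3$ such that $\pi(i_1)\pi(i_2)\pi(i_3)$ is order-isomorphic to $\sigma$, $i_{x+1}=i_x+1$ for every $x\in X$, and $j_{y+1}=j_y+1$ for every $y\in Y$, where $j_1<j_2<j_3$ are the three values $\pi(i_1),\pi(i_2),\pi(i_3)$ listed in increasing order; otherwise $\pi$ avoids it. For patterns $P_1,\dots,P_m$, $\mathrm{Av}_n(P_1,\dots,P_m)$ is the set of $\pi\in\mathcal{S}_n$ avoiding every $P_i$. Binomial coefficients use the convention $\binom{m}{0}=1$ for all integers $m$ (including $m=-1$) and $\binom{m}{j}=0$ for $0\le m<j$. -}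

module Defs where

open import Data.Nat using (ℕ; _+_; _∸_)
import Data.Nat as N
open import Data.Nat.Combinatorics using (_C_)
open import Data.Fin using (Fin; toℕ; inject₁; zero; suc) renaming (_<_ to _<ᶠ_)
open import Data.Fin.Subset using (Subset; _∈_; ⁅_⁆; ⊥)
open import Data.Vec using (Vec; lookup; _∷_; [])
open import Data.List using (List; length; map; upTo)
open import Data.Nat.ListAction using (sum)
open import Data.List.Relation.Unary.Unique.Propositional using (Unique)
import Data.List.Membership.Propositional as LM
open import Data.Product using (Σ; _×_; ∃)
open import Function.Bundles using (_⇔_)
open import Function.Definitions using (Injective)
open import Relation.Binary.PropositionalEquality using (_≡_)
open import Relation.Nullary using (¬_)

-- A permutation of [n] written as a word π(1)…π(n); values in Fin n
-- (value v ∈ Fin n stands for v+1 ∈ [n]); a word of length n with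
-- pairwise distinct entries (injective) is a permutation.
IsPerm : ∀ {n} → Vec (Fin n) n → Set
IsPerm π = Injective _≡_ _≡_ (lookup π)

-- A pattern of length 3: (σ, X, Y), σ ∈ S₃ as a word, X, Y ⊆ {1,2}
-- (position x ∈ {1,2} encoded as Fin 2 element x-1).
record Pattern : Set where
  constructor pat
  field
    σ : Vec (Fin 3) 3
    X : Subset 2
    Y : Subset 2

open Pattern

Occurs : ∀ {n} → Vec (Fin n) n → Pattern → (Fin 3 → Fin n) → Set
Occurs π P i =
  (i zero <ᶠ i (suc zero)) ×
  (i (suc zero) <ᶠ i (suc (suc zero))) ×
  (∀ a b → (lookup π (i a) <ᶠ lookup π (i b)) ⇔ (lookup (σ P) a <ᶠ lookup (σ P) b)) ×
  (∀ (x : Fin 2) → x ∈ X P → toℕ (i (suc x)) ≡ N.suc (toℕ (i (inject₁ x)))) ×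
  -- j_{y+1} = j_y + 1 for y ∈ Y, where j_k is the value of the entry of
  -- relative rank k, i.e. the entry at position a with σ(a) = k
  (∀ (y : Fin 2) → y ∈ Y P → ∀ a b →
     lookup (σ P) a ≡ inject₁ y → lookup (σ P) b ≡ suc y →
     toℕ (lookup π (i b)) ≡ N.suc (toℕ (lookup π (i a))))

Contains : ∀ {n} → Vec (Fin n) n → Pattern → Set
Contains π P = ∃ λ i → Occurs π P i

Avoids : ∀ {n} → Vec (Fin n) n → Pattern → Set
Avoids π P = ¬ Contains π P

InAv₂ : ∀ {n} → Pattern → Pattern → Vec (Fin n) n → Set
InAv₂ p r π = IsPerm π × Avoids π p × Avoids π r

HasCard : {A : Set} → (A → Set) → ℕ → Set
HasCard {A} P N = Σ (List A) λ L →
  Unique L × (∀ a → (a LM.∈ L) ⇔ P a) × (length L ≡ N)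

w123 : Vec (Fin 3) 3
w123 = zero ∷ suc zero ∷ suc (suc zero) ∷ []

-- p = (123, {2}, ∅),  r = (123, ∅, {2});  "2" ∈ {1,2} is Fin 2 element 1
pP : Pattern
pP = pat w123 ⁅ suc zero ⁆ ⊥

rP : Pattern
rP = pat w123 ⊥ ⁅ suc zero ⁆

-- ∑_{k=0}^{n} binom(binom(k+1,2) + n - k - 1, n - k).
-- For k = n the lower index is 0, so the term is 1 (matches the
-- convention binom(-1,0) = 1); truncated subtraction is harmless there.
term : ℕ → ℕ → ℕ
term n k = (((N.suc k) C 2) + (n ∸ k ∸ 1)) C (n ∸ k)

formula : ℕ → ℕ
formula n = sum (map (term n) (upTo (N.suc n)))

-- Every permutation avoiding p and r arises uniquely by inserting its maximum n into one of
-- length n, and the insertion creates no occurrence exactly when the site is admissible: it is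
-- the front, or it directly follows a left-to-right minimum, and if the old maximum n − 1 stands
-- before the site then it is a left-to-right minimum. Label π by (c, k), with k its number of left-to-right
-- minima and c its number of admissible sites other than the front. Inserting at the front gives
-- the label (k + 1, k + 1), inserting at the i-th other admissible site gives (i, k). Counting the
-- nodes at depth n below the root (0, 0) of this generating tree unfolds into the sum of the
-- multiset coefficients ((binom(k + 1, 2), n − k)), which is the stated sum.
module Submission where

open import Defs

open import Data.Empty using (⊥-elim)
open import Data.Fin using (Fin; toℕ; fromℕ; fromℕ<; inject₁) renaming (zero to fz; suc to fs)
import Data.Fin as Fin
open import Data.Fin.Properties
  using (toℕ-fromℕ<; toℕ-inject₁; toℕ-fromℕ; toℕ<n; toℕ-injective; injective⇒existsPivot)
import Data.Fin.Subset as Subset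
open import Data.Fin.Subset.Properties using (x∈⁅x⁆; x∈⁅y⁆⇒x≡y; ∉⊥)
open import Data.List using (List; []; _∷_; _++_; map; filter; length; concatMap; upTo; applyUpTo)
open import Data.List.Properties using (map-upTo; map-applyUpTo; map-∘; map-cong; map-cong-local; map-++)
open import Data.List.Membership.Propositional using (_∈_; find; lose)
open import Data.List.Membership.Propositional.Properties
  using (∈-map⁺; ∈-map⁻; ∈-filter⁺; ∈-filter⁻; ∈-concatMap⁺; ∈-concatMap⁻; ∈-upTo⁺; ∈-upTo⁻)
open import Data.List.Relation.Binary.Disjoint.Propositional using (Disjoint)
open import Data.List.Relation.Unary.Any using (here; there)
import Data.List.Relation.Unary.All as All
import Data.List.Relation.Unary.All.Properties as All
import Data.List.Relation.Unary.AllPairs as AllPairs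
import Data.List.Relation.Unary.AllPairs.Properties as AllPairs
open import Data.List.Relation.Unary.Unique.Propositional using (Unique; []; _∷_)
import Data.List.Relation.Unary.Unique.Propositional.Properties as Uniqueₚ
open import Data.Nat using (ℕ; zero; suc; _+_; _∸_; _≤_; _<_; z≤n; s≤s; z<s; _<?_; _≟_)
open import Data.Nat.Combinatorics using (_C_; nC1≡n; nCk+nC[k+1]≡[n+1]C[k+1]; k>n⇒nCk≡0)
open import Data.Nat.ListAction using (sum)
open import Data.Nat.ListAction.Properties using (sum-++)
open import Data.Nat.Properties
open import Algebra.Properties.CommutativeSemigroup +-commutativeSemigroup using (interchange)
open import Data.Product using (Σ; _×_; _,_; proj₁; proj₂)
open import Data.Product.Function.NonDependent.Propositional using (_×-⇔_)
open import Data.Sum using (_⊎_; inj₁; inj₂)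
open import Data.Vec using (Vec; []; _∷_; lookup)
import Data.Vec as Vec
open import Function using (_∘_)
open import Function.Bundles using (Equivalence; mk⇔; _⇔_)
open import Function.Construct.Composition using (_⇔-∘_)
open import Function.Construct.Symmetry using (⇔-sym)
open import Relation.Binary using (tri<; tri≈; tri>)
open import Relation.Binary.PropositionalEquality
open import Relation.Nullary using (¬_; Dec; yes; no; ¬?; _×-dec_; _→-dec_)
open import Relation.Nullary.Decidable using (map′)
open import Relation.Unary using (Decidable)

-- A word read as a function on ℕ; positions past the end read as 0.
entry : ∀ {n m} → Vec (Fin n) m → ℕ → ℕ
entry []       _       = 0
entry (x ∷ xs) zero    = toℕ x
entry (x ∷ xs) (suc i) = entry xs i

entry-lookup : ∀ {n m} (π : Vec (Fin n) m) (i : Fin m) → entry π (toℕ i) ≡ toℕ (lookup π i)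
entry-lookup (x ∷ π) fz     = refl
entry-lookup (x ∷ π) (fs i) = entry-lookup π i

entry<bound : ∀ {n m} (π : Vec (Fin n) m) {i} → i < m → entry π i < n
entry<bound (x ∷ π) {zero}  _         = toℕ<n x
entry<bound (x ∷ π) {suc i} (s≤s i<m) = entry<bound π i<m

lookup-fromℕ< : ∀ {n m} (π : Vec (Fin n) m) {i} (i<m : i < m) →
  toℕ (lookup π (fromℕ< i<m)) ≡ entry π i
lookup-fromℕ< π i<m = trans (sym (entry-lookup π _)) (cong (entry π) (toℕ-fromℕ< i<m))

entry-extensionality : ∀ {n m} (π σ : Vec (Fin n) m) →
  (∀ i → i < m → entry π i ≡ entry σ i) → π ≡ σ
entry-extensionality []      []      _ = refl
entry-extensionality (x ∷ π) (y ∷ σ) h =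
  cong₂ _∷_ (toℕ-injective (h 0 z<s)) (entry-extensionality π σ (λ i → h (suc i) ∘ s≤s))

InjectiveBelow : ℕ → (ℕ → ℕ) → Set
InjectiveBelow m f = ∀ i j → i < m → j < m → f i ≡ f j → i ≡ j

IsPerm⇔InjectiveBelow : ∀ {n} (π : Vec (Fin n) n) → IsPerm π ⇔ InjectiveBelow n (entry π)
IsPerm⇔InjectiveBelow π = mk⇔ to from
  where
  to : IsPerm π → InjectiveBelow _ (entry π)
  to inj i j i<n j<n e = begin
    i                  ≡⟨ toℕ-fromℕ< i<n ⟨
    toℕ (fromℕ< i<n)   ≡⟨ cong toℕ (inj (toℕ-injective lookups≡)) ⟩
    toℕ (fromℕ< j<n)   ≡⟨ toℕ-fromℕ< j<n ⟩
    j                  ∎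
    where
    open ≡-Reasoning
    lookups≡ : toℕ (lookup π (fromℕ< i<n)) ≡ toℕ (lookup π (fromℕ< j<n))
    lookups≡ = trans (lookup-fromℕ< π i<n) (trans e (sym (lookup-fromℕ< π j<n)))
  from : InjectiveBelow _ (entry π) → IsPerm π
  from h {x} {y} e = toℕ-injective (h (toℕ x) (toℕ y) (toℕ<n x) (toℕ<n y)
    (trans (entry-lookup π x) (trans (cong toℕ e) (sym (entry-lookup π y)))))

LeftToRightMin : (ℕ → ℕ) → ℕ → Set
LeftToRightMin f j = ∀ a → a < j → ¬ f a < f j

AvoidsP : ℕ → (ℕ → ℕ) → Set
AvoidsP n f = ∀ a j → a < j → suc j < n → f a < f j → ¬ f j < f (suc j)

AvoidsR : ℕ → (ℕ → ℕ) → Set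
AvoidsR n f = ∀ a b c → a < b → b < c → c < n → f a < f b → ¬ f c ≡ suc (f b)

AvoidsPR : ℕ → (ℕ → ℕ) → Set
AvoidsPR n f = AvoidsP n f × AvoidsR n f

IsomorphicTo123 : ∀ {n} → Vec (Fin n) n → (Fin 3 → Fin n) → Set
IsomorphicTo123 π i = ∀ x y → (lookup π (i x) Fin.< lookup π (i y)) ⇔ (lookup w123 x Fin.< lookup w123 y)

increasing⇒isomorphic-123 : ∀ {n} (π : Vec (Fin n) n) (i : Fin 3 → Fin n) →
  toℕ (lookup π (i fz)) < toℕ (lookup π (i (fs fz))) →
  toℕ (lookup π (i (fs fz))) < toℕ (lookup π (i (fs (fs fz)))) →
  IsomorphicTo123 π i
increasing⇒isomorphic-123 π i u v = λ where
  fz           fz           → mk⇔ (⊥-elim ∘ <-irrefl refl) λ ()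
  fz           (fs fz)      → mk⇔ (λ _ → z<s) (λ _ → u)
  fz           (fs (fs fz)) → mk⇔ (λ _ → z<s) (λ _ → <-trans u v)
  (fs fz)      fz           → mk⇔ (⊥-elim ∘ <-asym u) λ ()
  (fs fz)      (fs fz)      → mk⇔ (⊥-elim ∘ <-irrefl refl) λ { (s≤s ()) }
  (fs fz)      (fs (fs fz)) → mk⇔ (λ _ → s≤s z<s) (λ _ → v)
  (fs (fs fz)) fz           → mk⇔ (⊥-elim ∘ <-asym (<-trans u v)) λ ()
  (fs (fs fz)) (fs fz)      → mk⇔ (⊥-elim ∘ <-asym v) λ { (s≤s ()) }
  (fs (fs fz)) (fs (fs fz)) → mk⇔ (⊥-elim ∘ <-irrefl refl) λ { (s≤s (s≤s ())) }

module Occurrence {n} (π : Vec (Fin n) n) {a b c} (a<b : a < b) (b<c : b < c) (c<n : c < n) where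

  private
    b<n : b < n
    b<n = <-trans b<c c<n

    a<n : a < n
    a<n = <-trans a<b b<n

  positions : Fin 3 → Fin n
  positions fz           = fromℕ< a<n
  positions (fs fz)      = fromℕ< b<n
  positions (fs (fs fz)) = fromℕ< c<n

  module _ (ab : entry π a < entry π b) (bc : entry π b < entry π c) where

    isomorphic : IsomorphicTo123 π positions
    isomorphic = increasing⇒isomorphic-123 π positions
      (subst₂ _<_ (sym (lookup-fromℕ< π a<n)) (sym (lookup-fromℕ< π b<n)) ab)
      (subst₂ _<_ (sym (lookup-fromℕ< π b<n)) (sym (lookup-fromℕ< π c<n)) bc)

    ordered₁ : positions fz Fin.< positions (fs fz)
    ordered₁ = subst₂ _<_ (sym (toℕ-fromℕ< a<n)) (sym (toℕ-fromℕ< b<n)) a<b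

    ordered₂ : positions (fs fz) Fin.< positions (fs (fs fz))
    ordered₂ = subst₂ _<_ (sym (toℕ-fromℕ< b<n)) (sym (toℕ-fromℕ< c<n)) b<c

    occurrence-p : c ≡ suc b → Contains π pP
    occurrence-p c≡1+b = positions , ordered₁ , ordered₂ , isomorphic , adjacent , λ _ → ⊥-elim ∘ ∉⊥
      where
      adjacent : ∀ x → x Subset.∈ Subset.⁅ fs fz ⁆ →
        toℕ (positions (fs x)) ≡ suc (toℕ (positions (inject₁ x)))
      adjacent x x∈ with refl ← x∈⁅y⁆⇒x≡y (fs fz) x∈ =
        trans (toℕ-fromℕ< c<n) (trans c≡1+b (cong suc (sym (toℕ-fromℕ< b<n))))

    occurrence-r : entry π c ≡ suc (entry π b) → Contains π rP
    occurrence-r c≡1+b = positions , ordered₁ , ordered₂ , isomorphic , (λ _ → ⊥-elim ∘ ∉⊥) , adjacent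
      where
      adjacent : ∀ y → y Subset.∈ Subset.⁅ fs fz ⁆ →
        ∀ p q → lookup w123 p ≡ inject₁ y → lookup w123 q ≡ fs y →
        toℕ (lookup π (positions q)) ≡ suc (toℕ (lookup π (positions p)))
      adjacent y y∈ p q with x∈⁅y⁆⇒x≡y (fs fz) y∈
      adjacent y y∈ (fs fz) (fs (fs fz)) | refl = λ _ _ →
        trans (lookup-fromℕ< π c<n) (trans c≡1+b (cong suc (sym (lookup-fromℕ< π b<n))))
      adjacent y y∈ fz           q       | refl = λ ()
      adjacent y y∈ (fs (fs fz)) q       | refl = λ ()
      adjacent y y∈ (fs fz)      fz      | refl = λ _ ()
      adjacent y y∈ (fs fz)      (fs fz) | refl = λ _ ()

module _ {n} (π : Vec (Fin n) n) where

  private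
    rise₀₁ : (i : Fin 3 → Fin n) → IsomorphicTo123 π i →
      entry π (toℕ (i fz)) < entry π (toℕ (i (fs fz)))
    rise₀₁ i iso = subst₂ _<_ (sym (entry-lookup π (i fz))) (sym (entry-lookup π (i (fs fz))))
      (Equivalence.from (iso fz (fs fz)) (s≤s z≤n))

  Avoids-pP⇔AvoidsP : Avoids π pP ⇔ AvoidsP n (entry π)
  Avoids-pP⇔AvoidsP = mk⇔ to from
    where
    to : Avoids π pP → AvoidsP n (entry π)
    to av a j a<j 1+j<n fa<fj fj<f1+j = av (occurrence-p fa<fj fj<f1+j refl)
      where open Occurrence π a<j (n<1+n j) 1+j<n
    from : AvoidsP n (entry π) → Avoids π pP
    from avoids (i , i₀<i₁ , _ , iso , adjacent , _) =
      avoids _ _ i₀<i₁ i₁+1<n (rise₀₁ i iso) rise₁₂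
      where
      i₂≡i₁+1 : toℕ (i (fs (fs fz))) ≡ suc (toℕ (i (fs fz)))
      i₂≡i₁+1 = adjacent (fs fz) (x∈⁅x⁆ (fs fz))
      i₁+1<n : suc (toℕ (i (fs fz))) < n
      i₁+1<n = subst (_< n) i₂≡i₁+1 (toℕ<n _)
      rise₁₂ : entry π (toℕ (i (fs fz))) < entry π (suc (toℕ (i (fs fz))))
      rise₁₂ = subst₂ _<_ (sym (entry-lookup π (i (fs fz))))
        (trans (sym (entry-lookup π (i (fs (fs fz))))) (cong (entry π) i₂≡i₁+1))
        (Equivalence.from (iso (fs fz) (fs (fs fz))) (s≤s (s≤s z≤n)))

  Avoids-rP⇔AvoidsR : Avoids π rP ⇔ AvoidsR n (entry π)
  Avoids-rP⇔AvoidsR = mk⇔ to from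
    where
    to : Avoids π rP → AvoidsR n (entry π)
    to av a b c a<b b<c c<n fa<fb fc≡1+fb =
      av (occurrence-r fa<fb (subst (entry π b <_) (sym fc≡1+fb) (n<1+n _)) fc≡1+fb)
      where open Occurrence π a<b b<c c<n
    from : AvoidsR n (entry π) → Avoids π rP
    from avoids (i , i₀<i₁ , i₁<i₂ , iso , _ , adjacent) =
      avoids _ _ _ i₀<i₁ i₁<i₂ (toℕ<n _) (rise₀₁ i iso) consecutive
      where
      consecutive : entry π (toℕ (i (fs (fs fz)))) ≡ suc (entry π (toℕ (i (fs fz))))
      consecutive = trans (entry-lookup π _)
        (trans (adjacent (fs fz) (x∈⁅x⁆ (fs fz)) (fs fz) (fs (fs fz)) refl refl) (cong suc (sym (entry-lookup π _))))

punchInℕ : ℕ → ℕ → ℕ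
punchInℕ q i with i <? q
... | yes _ = i
... | no _  = suc i

punchInℕ<1+n : ∀ {q i n} → i < n → punchInℕ q i < suc n
punchInℕ<1+n {q} {i} {n} i<n with i <? q
... | yes _ = <-trans i<n (n<1+n n)
... | no _  = s≤s i<n

punchInℕ-mono : ∀ {q i j} → i < j → punchInℕ q i < punchInℕ q j
punchInℕ-mono {q} {i} {j} i<j with i <? q | j <? q
... | yes _  | yes _   = i<j
... | yes _  | no _    = <-trans i<j (n<1+n j)
... | no i≮q | yes j<q = ⊥-elim (i≮q (<-trans i<j j<q))
... | no _   | no _    = s≤s i<j

punchInℕ-suc : ∀ {q} j → suc j ≢ q → punchInℕ q (suc j) ≡ suc (punchInℕ q j)
punchInℕ-suc {q} j 1+j≢q with j <? q | suc j <? q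
... | yes _   | yes _     = refl
... | yes j<q | no 1+j≮q  = ⊥-elim (1+j≢q (≤-antisym j<q (≮⇒≥ 1+j≮q)))
... | no j≮q  | yes 1+j<q = ⊥-elim (j≮q (<-trans (n<1+n j) 1+j<q))
... | no _    | no _      = refl

record MaxInsertion (n q : ℕ) (f g : ℕ → ℕ) : Set where
  field
    q≤n     : q ≤ n
    before  : ∀ i → i < q → g i ≡ f i
    at-site : g q ≡ n
    after   : ∀ i → q ≤ i → g (suc i) ≡ f i
    f<n     : ∀ i → i < n → f i < n

MaxIsLRMinBefore : ℕ → (ℕ → ℕ) → ℕ → Set
MaxIsLRMinBefore n f q = ∀ b → b < q → suc (f b) ≡ n → LeftToRightMin f b

Admissible : ℕ → (ℕ → ℕ) → ℕ → Set
Admissible n f q = (q ≡ 0 ⊎ Σ ℕ λ j → q ≡ suc j × LeftToRightMin f j) × MaxIsLRMinBefore n f q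

module MaxInsertionProperties {n q f g} (I : MaxInsertion n q f g) where
  open MaxInsertion I

  data Position (i : ℕ) : Set where
    pos-before : i < q → g i ≡ f i → Position i
    pos-site   : i ≡ q → Position i
    pos-after  : ∀ i′ → i ≡ suc i′ → q ≤ i′ → i′ < n → g i ≡ f i′ → Position i

  position : ∀ i → i < suc n → Position i
  position i i<1+n with <-cmp i q
  ... | tri< i<q _ _ = pos-before i<q (before i i<q)
  ... | tri≈ _ i≡q _ = pos-site i≡q
  position (suc i) (s≤s i<n) | tri> _ _ (s≤s q≤i) = pos-after i refl q≤i i<n (after i q≤i)

  g<n-off-site : ∀ i → i < suc n → i ≢ q → g i < n
  g<n-off-site i i<1+n i≢q with position i i<1+n
  ... | pos-before i<q gi = subst (_< n) (sym gi) (f<n i (<-≤-trans i<q q≤n))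
  ... | pos-site i≡q = ⊥-elim (i≢q i≡q)
  ... | pos-after i′ _ _ i′<n gi = subst (_< n) (sym gi) (f<n i′ i′<n)

  site-unique : ∀ i → i < suc n → g i ≡ n → i ≡ q
  site-unique i i<1+n gi≡n with i ≟ q
  ... | yes i≡q = i≡q
  ... | no i≢q  = ⊥-elim (<⇒≢ (g<n-off-site i i<1+n i≢q) gi≡n)

  g-punchIn : ∀ i → g (punchInℕ q i) ≡ f i
  g-punchIn i with i <? q
  ... | yes i<q = before i i<q
  ... | no i≮q  = after i (≮⇒≥ i≮q)

  g≡g-punchIn : ∀ {i j} → f i ≡ f j → g (punchInℕ q i) ≡ g (punchInℕ q j)
  g≡g-punchIn fi≡fj = trans (g-punchIn _) (trans fi≡fj (sym (g-punchIn _)))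

  InjectiveBelow-insert⇔ : InjectiveBelow (suc n) g ⇔ InjectiveBelow n f
  InjectiveBelow-insert⇔ = mk⇔ to from
    where
    to : InjectiveBelow (suc n) g → InjectiveBelow n f
    to inj i j i<n j<n fi≡fj with <-cmp i j
    ... | tri≈ _ i≡j _ = i≡j
    ... | tri< i<j _ _ =
      ⊥-elim (<⇒≢ (punchInℕ-mono i<j)
        (inj _ _ (punchInℕ<1+n i<n) (punchInℕ<1+n j<n) (g≡g-punchIn fi≡fj)))
    ... | tri> _ _ j<i =
      ⊥-elim (<⇒≢ (punchInℕ-mono j<i)
        (inj _ _ (punchInℕ<1+n j<n) (punchInℕ<1+n i<n) (g≡g-punchIn (sym fi≡fj))))
    from : InjectiveBelow n f → InjectiveBelow (suc n) g
    from inj i j i<1+n j<1+n gi≡gj with position i i<1+n | position j j<1+n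
    ... | pos-site refl | pos-site refl = refl
    ... | pos-site refl | _ = sym (site-unique j j<1+n (trans (sym gi≡gj) at-site))
    ... | _ | pos-site refl = site-unique i i<1+n (trans gi≡gj at-site)
    ... | pos-before i<q gi | pos-before j<q gj =
      inj i j (<-≤-trans i<q q≤n) (<-≤-trans j<q q≤n) (trans (sym gi) (trans gi≡gj gj))
    ... | pos-after i′ refl _ i′<n gi | pos-after j′ refl _ j′<n gj =
      cong suc (inj i′ j′ i′<n j′<n (trans (sym gi) (trans gi≡gj gj)))
    ... | pos-before i<q gi | pos-after j′ refl q≤j′ j′<n gj =
      ⊥-elim (<⇒≱ i<q (≤-trans q≤j′ (≤-reflexive (sym i≡j′))))
      where
      i≡j′ : i ≡ j′
      i≡j′ = inj i j′ (<-≤-trans i<q q≤n) j′<n (trans (sym gi) (trans gi≡gj gj))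
    ... | pos-after i′ refl q≤i′ i′<n gi | pos-before j<q gj =
      ⊥-elim (<⇒≱ j<q (≤-trans q≤i′ (≤-reflexive (sym j≡i′))))
      where
      j≡i′ : j ≡ i′
      j≡i′ = inj j i′ (<-≤-trans j<q q≤n) i′<n (trans (sym gj) (trans (sym gi≡gj) gi))

  g<g-punchIn : ∀ {i j} → f i < f j → g (punchInℕ q i) < g (punchInℕ q j)
  g<g-punchIn = subst₂ _<_ (sym (g-punchIn _)) (sym (g-punchIn _))

  g<g-before : ∀ {i j} → i < q → j < q → f i < f j → g i < g j
  g<g-before i<q j<q = subst₂ _<_ (sym (before _ i<q)) (sym (before _ j<q))

  AvoidsP-remove : AvoidsP (suc n) g → AvoidsP n f
  AvoidsP-remove avoids a j a<j 1+j<n fa<fj fj<f1+j with suc j ≟ q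
  ... | yes refl = avoids a j a<j (<-trans 1+j<n (n<1+n n)) (g<g-before (<-trans a<j (n<1+n j)) (n<1+n j) fa<fj)
                     (subst₂ _<_ (sym (before j (n<1+n j))) (sym at-site) (f<n j (<-trans (n<1+n j) 1+j<n)))
  ... | no 1+j≢q = avoids (punchInℕ q a) (punchInℕ q j) (punchInℕ-mono a<j)
                     (subst (_< suc n) (punchInℕ-suc j 1+j≢q) (punchInℕ<1+n 1+j<n)) (g<g-punchIn fa<fj)
                     (subst (g (punchInℕ q j) <_) (cong g (punchInℕ-suc j 1+j≢q)) (g<g-punchIn fj<f1+j))

  AvoidsR-remove : AvoidsR (suc n) g → AvoidsR n f
  AvoidsR-remove avoids a b c a<b b<c c<n fa<fb fc≡1+fb =
    avoids (punchInℕ q a) (punchInℕ q b) (punchInℕ q c) (punchInℕ-mono a<b) (punchInℕ-mono b<c)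
      (punchInℕ<1+n c<n) (g<g-punchIn fa<fb)
      (trans (g-punchIn c) (trans fc≡1+fb (cong suc (sym (g-punchIn b)))))

  site-admissible : AvoidsPR (suc n) g → Admissible n f q
  site-admissible (avoidsP , avoidsR) = site q refl , max-before
    where
    site : ∀ q′ → q′ ≡ q → q ≡ 0 ⊎ Σ ℕ λ j → q ≡ suc j × LeftToRightMin f j
    site zero    refl = inj₁ refl
    site (suc j) refl = inj₂ (j , refl , λ a a<j fa<fj →
      avoidsP a j a<j (s≤s q≤n) (g<g-before (<-trans a<j (n<1+n j)) (n<1+n j) fa<fj)
        (subst₂ _<_ (sym (before j (n<1+n j))) (sym at-site) (f<n j q≤n)))
    max-before : MaxIsLRMinBefore n f q
    max-before b b<q 1+fb≡n a a<b fa<fb =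
      avoidsR a b q a<b b<q (s≤s q≤n) (g<g-before (<-trans a<b b<q) b<q fa<fb)
        (trans at-site (trans (sym 1+fb≡n) (cong suc (sym (before b b<q)))))

  AvoidsP-insert : Admissible n f q → AvoidsP n f → AvoidsP (suc n) g
  AvoidsP-insert (site , _) avoids a j a<j 1+j<1+n ga<gj gj<g1+j with position (suc j) 1+j<1+n
  ... | pos-before 1+j<q g1+j =
    avoids a j a<j (<-≤-trans 1+j<q q≤n) (subst₂ _<_ (before a a<q) (before j j<q) ga<gj)
      (subst₂ _<_ (before j j<q) g1+j gj<g1+j)
    where
    j<q : j < q
    j<q = <-trans (n<1+n j) 1+j<q
    a<q : a < q
    a<q = <-trans a<j j<q
  ... | pos-site 1+j≡q with site
  ...   | inj₁ q≡0 = ⊥-elim (1+n≢0 (trans 1+j≡q q≡0))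
  ...   | inj₂ (j′ , q≡1+j′ , lrmin) with suc-injective (trans 1+j≡q q≡1+j′)
  ...     | refl = lrmin a a<j (subst₂ _<_ (before a a<q) (before j j<q) ga<gj)
    where
    j<q : j < q
    j<q = subst (j <_) 1+j≡q (n<1+n j)
    a<q : a < q
    a<q = <-trans a<j j<q
  AvoidsP-insert _ avoids a j a<j _ ga<gj gj<g1+j
    | pos-after _ refl q≤j j<n g1+j with position j (<-trans j<n (n<1+n n))
  ... | pos-before j<q _ = ⊥-elim (<⇒≱ j<q q≤j)
  ... | pos-site refl = <-asym gj<g1+j (subst₂ _<_ (sym g1+j) (sym at-site) (f<n j j<n))
  ... | pos-after j′ refl q≤j′ _ gj with position a (<-trans a<j (<-trans j<n (n<1+n n)))
  ...   | pos-before a<q ga =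
    avoids a j′ (<-≤-trans a<q q≤j′) j<n (subst₂ _<_ ga gj ga<gj) (subst₂ _<_ gj g1+j gj<g1+j)
  ...   | pos-site refl =
    <-asym ga<gj (subst₂ _<_ (sym gj) (sym at-site) (f<n j′ (<-trans (n<1+n j′) j<n)))
  ...   | pos-after a′ refl _ _ ga =
    avoids a′ j′ (≤-pred a<j) j<n (subst₂ _<_ ga gj ga<gj) (subst₂ _<_ gj g1+j gj<g1+j)

  AvoidsR-insert : Admissible n f q → AvoidsR n f → AvoidsR (suc n) g
  AvoidsR-insert (_ , max-before) avoids a b c a<b b<c c<1+n ga<gb gc≡1+gb with position c c<1+n
  ... | pos-before c<q gc =
    avoids a b c a<b b<c (<-≤-trans c<q q≤n) (subst₂ _<_ (before a a<q) (before b b<q) ga<gb)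
      (trans (sym gc) (trans gc≡1+gb (cong suc (before b b<q))))
    where
    b<q : b < q
    b<q = <-trans b<c c<q
    a<q : a < q
    a<q = <-trans a<b b<q
  ... | pos-site refl =
    max-before b b<c (trans (cong suc (sym (before b b<c))) (trans (sym gc≡1+gb) at-site)) a a<b
      (subst₂ _<_ (before a (<-trans a<b b<c)) (before b b<c) ga<gb)
  ... | pos-after c′ refl q≤c′ c′<n gc with position b (<-trans b<c c<1+n)
  ...   | pos-before b<q gb =
    avoids a b c′ a<b (<-≤-trans b<q q≤c′) c′<n (subst₂ _<_ (before a (<-trans a<b b<q)) gb ga<gb)
      (trans (sym gc) (trans gc≡1+gb (cong suc gb)))
  ...   | pos-site refl = <-asym (f<n c′ c′<n) (subst (n <_) (sym fc′≡1+n) (n<1+n n))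
    where
    fc′≡1+n : f c′ ≡ suc n
    fc′≡1+n = trans (sym gc) (trans gc≡1+gb (cong suc at-site))
  ...   | pos-after b′ refl q≤b′ _ gb with position a (<-trans a<b (<-trans b<c c<1+n))
  ...     | pos-before a<q ga =
    avoids a b′ c′ (<-≤-trans a<q q≤b′) (≤-pred b<c) c′<n (subst₂ _<_ ga gb ga<gb)
      (trans (sym gc) (trans gc≡1+gb (cong suc gb)))
  ...     | pos-site refl =
    <-asym ga<gb (subst₂ _<_ (sym gb) (sym at-site) (f<n b′ (<-trans (≤-pred b<c) c′<n)))
  ...     | pos-after a′ refl _ _ ga =
    avoids a′ b′ c′ (≤-pred a<b) (≤-pred b<c) c′<n (subst₂ _<_ ga gb ga<gb)
      (trans (sym gc) (trans gc≡1+gb (cong suc gb)))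

  AvoidsPR-insert⇔ : AvoidsPR (suc n) g ⇔ (AvoidsPR n f × Admissible n f q)
  AvoidsPR-insert⇔ = mk⇔
    (λ avoids → (AvoidsP-remove (proj₁ avoids) , AvoidsR-remove (proj₂ avoids)) , site-admissible avoids)
    (λ ((avoidsP , avoidsR) , adm) → AvoidsP-insert adm avoidsP , AvoidsR-insert adm avoidsR)

insert : ∀ {A : Set} {m} → ℕ → A → Vec A m → Vec A (suc m)
insert zero    a xs       = a ∷ xs
insert (suc q) a []       = a ∷ []
insert (suc q) a (x ∷ xs) = x ∷ insert q a xs

insertMax : ∀ {n} → ℕ → Vec (Fin n) n → Vec (Fin (suc n)) (suc n)
insertMax {n} q π = insert q (fromℕ n) (Vec.map inject₁ π)

entry-map-inject₁ : ∀ {n m} (xs : Vec (Fin n) m) i → entry (Vec.map inject₁ xs) i ≡ entry xs i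
entry-map-inject₁ []       i       = refl
entry-map-inject₁ (x ∷ xs) zero    = toℕ-inject₁ x
entry-map-inject₁ (x ∷ xs) (suc i) = entry-map-inject₁ xs i

module _ {N} (a : Fin N) where

  entry-insert-before : ∀ {m} q (xs : Vec (Fin N) m) i → i < q → q ≤ m →
    entry (insert q a xs) i ≡ entry xs i
  entry-insert-before (suc q) (x ∷ xs) zero    _         _         = refl
  entry-insert-before (suc q) (x ∷ xs) (suc i) (s≤s i<q) (s≤s q≤m) =
    entry-insert-before q xs i i<q q≤m

  entry-insert-at : ∀ {m} q (xs : Vec (Fin N) m) → q ≤ m → entry (insert q a xs) q ≡ toℕ a
  entry-insert-at zero    xs       _         = refl
  entry-insert-at (suc q) (x ∷ xs) (s≤s q≤m) = entry-insert-at q xs q≤m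

  entry-insert-after : ∀ {m} q (xs : Vec (Fin N) m) i → q ≤ i → q ≤ m →
    entry (insert q a xs) (suc i) ≡ entry xs i
  entry-insert-after zero    xs       i       _         _         = refl
  entry-insert-after (suc q) (x ∷ xs) (suc i) (s≤s q≤i) (s≤s q≤m) =
    entry-insert-after q xs i q≤i q≤m

insertMax-MaxInsertion : ∀ {n} (π : Vec (Fin n) n) {q} → q ≤ n →
  MaxInsertion n q (entry π) (entry (insertMax q π))
insertMax-MaxInsertion {n} π {q} q≤n = record
  { q≤n     = q≤n
  ; before  = λ i i<q → trans (entry-insert-before _ q _ i i<q q≤n) (entry-map-inject₁ π i)
  ; at-site = trans (entry-insert-at _ q _ q≤n) (toℕ-fromℕ n)
  ; after   = λ i q≤i → trans (entry-insert-after _ q _ i q≤i q≤n) (entry-map-inject₁ π i)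
  ; f<n     = λ i → entry<bound π
  }

insertMax-injective : ∀ {n} (π σ : Vec (Fin n) n) {q r} → q ≤ n → r ≤ n →
  insertMax q π ≡ insertMax r σ → q ≡ r × π ≡ σ
insertMax-injective {n} π σ {q} {r} q≤n r≤n eq = q≡r , entry-extensionality π σ entries≡
  where
  module I = MaxInsertionProperties (insertMax-MaxInsertion π q≤n)
  module J = MaxInsertionProperties (insertMax-MaxInsertion σ r≤n)
  entry≡ : ∀ i → entry (insertMax q π) i ≡ entry (insertMax r σ) i
  entry≡ i = cong (λ v → entry v i) eq
  q≡r : q ≡ r
  q≡r = J.site-unique q (s≤s q≤n)
    (trans (sym (entry≡ q)) (MaxInsertion.at-site (insertMax-MaxInsertion π q≤n)))
  entries≡ : ∀ i → i < n → entry π i ≡ entry σ i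
  entries≡ i _ = begin
    entry π i                                ≡⟨ I.g-punchIn i ⟨
    entry (insertMax q π) (punchInℕ q i)     ≡⟨ entry≡ (punchInℕ q i) ⟩
    entry (insertMax r σ) (punchInℕ q i)     ≡⟨ cong (λ s → entry (insertMax r σ) (punchInℕ s i)) q≡r ⟩
    entry (insertMax r σ) (punchInℕ r i)     ≡⟨ J.g-punchIn i ⟩
    entry σ i                                ∎
    where open ≡-Reasoning

remove : ∀ {A : Set} {m} → ℕ → Vec A (suc m) → Vec A m
remove zero    (x ∷ xs)     = xs
remove (suc q) (x ∷ [])     = []
remove (suc q) (x ∷ y ∷ xs) = x ∷ remove q (y ∷ xs)

entry-remove-before : ∀ {N m} q (xs : Vec (Fin N) (suc m)) i → i < q → q ≤ m →
  entry (remove q xs) i ≡ entry xs i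
entry-remove-before (suc q) (x ∷ y ∷ xs) zero    _         _         = refl
entry-remove-before (suc q) (x ∷ y ∷ xs) (suc i) (s≤s i<q) (s≤s q≤m) =
  entry-remove-before q (y ∷ xs) i i<q q≤m

entry-remove-after : ∀ {N m} q (xs : Vec (Fin N) (suc m)) i → q ≤ i →
  entry (remove q xs) i ≡ entry xs (suc i)
entry-remove-after zero    (x ∷ xs)     i       _         = refl
entry-remove-after (suc q) (x ∷ [])     (suc i) _         = refl
entry-remove-after (suc q) (x ∷ y ∷ xs) (suc i) (s≤s q≤i) = entry-remove-after q (y ∷ xs) i q≤i

-- Identity below the top element, which is sent to the junk value 0.
lower : ∀ {m} → Fin (suc (suc m)) → Fin (suc m)
lower         fz     = fz
lower {zero}  (fs _) = fz
lower {suc m} (fs i) = fs (lower i)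

toℕ-lower : ∀ {m} (x : Fin (suc (suc m))) → toℕ x < suc m → toℕ (lower x) ≡ toℕ x
toℕ-lower         fz     _       = refl
toℕ-lower {suc m} (fs x) (s≤s h) = cong suc (toℕ-lower x h)

entry-map-lower : ∀ {m k} (xs : Vec (Fin (suc (suc m))) k) i → entry xs i < suc m →
  entry (Vec.map lower xs) i ≡ entry xs i
entry-map-lower []       i       _ = refl
entry-map-lower (x ∷ xs) zero    h = toℕ-lower x h
entry-map-lower (x ∷ xs) (suc i) h = entry-map-lower xs i h

insertMax-surjective : ∀ {n} (σ : Vec (Fin (suc n)) (suc n)) → IsPerm σ →
  Σ ℕ λ q → q ≤ n × Σ (Vec (Fin n) n) λ π → σ ≡ insertMax q π
insertMax-surjective {zero}  (fz ∷ []) _      = 0 , z≤n , [] , refl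
insertMax-surjective {suc n} σ         σ-perm =
  q , q≤1+n , π , entry-extensionality σ (insertMax q π) entries≡
  where
  pivot : Σ (Fin (suc (suc n))) λ j → j Fin.≤ fromℕ (suc n) × fromℕ (suc n) Fin.≤ lookup σ j
  pivot = injective⇒existsPivot σ-perm (fromℕ (suc n))
  q : ℕ
  q = toℕ (proj₁ pivot)
  q≤1+n : q ≤ suc n
  q≤1+n = subst (q ≤_) (toℕ-fromℕ (suc n)) (proj₁ (proj₂ pivot))
  σq≡1+n : entry σ q ≡ suc n
  σq≡1+n = trans (entry-lookup σ (proj₁ pivot))
    (≤-antisym (m<1+n⇒m≤n (toℕ<n (lookup σ _)))
      (subst (_≤ toℕ (lookup σ (proj₁ pivot))) (toℕ-fromℕ (suc n)) (proj₂ (proj₂ pivot))))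
  σ<1+n-off-q : ∀ i → i < suc (suc n) → i ≢ q → entry σ i < suc n
  σ<1+n-off-q i i<2+n i≢q with m<1+n⇒m<n∨m≡n (entry<bound σ i<2+n)
  ... | inj₁ σi<1+n = σi<1+n
  ... | inj₂ σi≡1+n = ⊥-elim (i≢q
    (Equivalence.to (IsPerm⇔InjectiveBelow σ) σ-perm i q i<2+n (s≤s q≤1+n) (trans σi≡1+n (sym σq≡1+n))))
  removed<1+n : ∀ i → i < suc n → entry (remove q σ) i < suc n
  removed<1+n i i<1+n with i <? q
  ... | yes i<q = subst (_< suc n) (sym (entry-remove-before q σ i i<q q≤1+n))
                    (σ<1+n-off-q i (<-trans i<1+n (n<1+n _)) (<⇒≢ i<q))
  ... | no i≮q  = subst (_< suc n) (sym (entry-remove-after q σ i (≮⇒≥ i≮q)))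
                    (σ<1+n-off-q (suc i) (s≤s i<1+n) (λ 1+i≡q → i≮q (≤-reflexive 1+i≡q)))
  π : Vec (Fin (suc n)) (suc n)
  π = Vec.map lower (remove q σ)
  entry-π : ∀ i → i < suc n → entry π i ≡ entry (remove q σ) i
  entry-π i i<1+n = entry-map-lower (remove q σ) i (removed<1+n i i<1+n)
  open MaxInsertion (insertMax-MaxInsertion π q≤1+n) using (at-site)
  open MaxInsertionProperties (insertMax-MaxInsertion π q≤1+n)
    using (position; pos-before; pos-site; pos-after)
  entries≡ : ∀ i → i < suc (suc n) → entry σ i ≡ entry (insertMax q π) i
  entries≡ i i<2+n with position i i<2+n
  ... | pos-before i<q gi =
    sym (trans gi (trans (entry-π i (<-≤-trans i<q q≤1+n)) (entry-remove-before q σ i i<q q≤1+n)))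
  ... | pos-site refl = trans σq≡1+n (sym at-site)
  ... | pos-after i′ refl q≤i′ i′<1+n gi =
    sym (trans gi (trans (entry-π i′ i′<1+n) (entry-remove-after q σ i′ q≤i′)))

indicator : {A : Set} → Dec A → ℕ
indicator (yes _) = 1
indicator (no _)  = 0

indicator-cong : {A B : Set} (a? : Dec A) (b? : Dec B) → A ⇔ B → indicator a? ≡ indicator b?
indicator-cong (yes _) (yes _) _   = refl
indicator-cong (no _)  (no _)  _   = refl
indicator-cong (yes a) (no ¬b) A⇔B = ⊥-elim (¬b (Equivalence.to A⇔B a))
indicator-cong (no ¬a) (yes b) A⇔B = ⊥-elim (¬a (Equivalence.from A⇔B b))

indicator-yes : {A : Set} (a? : Dec A) → A → indicator a? ≡ 1
indicator-yes (yes _) _ = refl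
indicator-yes (no ¬a) a = ⊥-elim (¬a a)

indicator-no : {A : Set} (a? : Dec A) → ¬ A → indicator a? ≡ 0
indicator-no (yes a) ¬a = ⊥-elim (¬a a)
indicator-no (no _)  _  = refl

countBelow : {P : ℕ → Set} → Decidable P → ℕ → ℕ
countBelow P? zero    = 0
countBelow P? (suc n) = indicator (P? 0) + countBelow (P? ∘ suc) n

countBelow-none : ∀ {P : ℕ → Set} (P? : Decidable P) n → (∀ i → i < n → ¬ P i) → countBelow P? n ≡ 0
countBelow-none P? zero    _  = refl
countBelow-none P? (suc n) ¬P =
  cong₂ _+_ (indicator-no (P? 0) (¬P 0 z<s)) (countBelow-none (P? ∘ suc) n (λ i → ¬P (suc i) ∘ s≤s))

countBelow-cong : ∀ {P Q : ℕ → Set} (P? : Decidable P) (Q? : Decidable Q) → ∀ n →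
  (∀ i → i < n → P i ⇔ Q i) → countBelow P? n ≡ countBelow Q? n
countBelow-cong P? Q? zero    _   = refl
countBelow-cong P? Q? (suc n) P⇔Q =
  cong₂ _+_ (indicator-cong (P? 0) (Q? 0) (P⇔Q 0 z<s))
    (countBelow-cong (P? ∘ suc) (Q? ∘ suc) n (λ i → P⇔Q (suc i) ∘ s≤s))

countBelow-prefix : ∀ {P Q : ℕ → Set} (P? : Decidable P) (Q? : Decidable Q) → ∀ m N → m ≤ N →
  (∀ i → i < m → P i ⇔ Q i) → (∀ i → m ≤ i → i < N → ¬ P i) → countBelow P? N ≡ countBelow Q? m
countBelow-prefix P? Q? zero    N       _         _   ¬P = countBelow-none P? N (λ i → ¬P i z≤n)
countBelow-prefix P? Q? (suc m) (suc N) (s≤s m≤N) P⇔Q ¬P =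
  cong₂ _+_ (indicator-cong (P? 0) (Q? 0) (P⇔Q 0 z<s))
    (countBelow-prefix (P? ∘ suc) (Q? ∘ suc) m N m≤N (λ i → P⇔Q (suc i) ∘ s≤s)
      (λ i m≤i i<N → ¬P (suc i) (s≤s m≤i) (s≤s i<N)))

countBelow-skip : ∀ {P Q : ℕ → Set} (P? : Decidable P) (Q? : Decidable Q) → ∀ q n → q ≤ n → ¬ P q →
  (∀ i → i < q → P i ⇔ Q i) → (∀ i → q ≤ i → i < n → P (suc i) ⇔ Q i) →
  countBelow P? (suc n) ≡ countBelow Q? n
countBelow-skip P? Q? zero    n       _         ¬Pq _       P⇔Q =
  cong₂ _+_ (indicator-no (P? 0) ¬Pq) (countBelow-cong (P? ∘ suc) Q? n (λ i → P⇔Q i z≤n))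
countBelow-skip P? Q? (suc q) (suc n) (s≤s q≤n) ¬Pq P⇔Q-pre P⇔Q =
  cong₂ _+_ (indicator-cong (P? 0) (Q? 0) (P⇔Q-pre 0 z<s))
    (countBelow-skip (P? ∘ suc) (Q? ∘ suc) q n q≤n ¬Pq (λ i → P⇔Q-pre (suc i) ∘ s≤s)
      (λ i q≤i i<n → P⇔Q (suc i) (s≤s q≤i) (s≤s i<n)))

filter-map : ∀ {A B : Set} {P : B → Set} (P? : Decidable P) (f : A → B) (xs : List A) →
  filter P? (map f xs) ≡ map f (filter (P? ∘ f) xs)
filter-map P? f []       = refl
filter-map P? f (x ∷ xs) with P? (f x)
... | yes _ = cong (f x ∷_) (filter-map P? f xs)
... | no _  = filter-map P? f xs

map⁺-injectiveOn : ∀ {A B : Set} (f : A → B) {xs : List A} →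
  (∀ {x y} → x ∈ xs → y ∈ xs → f x ≡ f y → x ≡ y) → Unique xs → Unique (map f xs)
map⁺-injectiveOn f {[]}     _   []           = []
map⁺-injectiveOn f {x ∷ xs} inj (x∉xs ∷ xs!) =
  All.map⁺ (All.tabulate λ y∈ fx≡fy → All.lookup x∉xs y∈ (inj (here refl) (there y∈) fx≡fy))
  ∷ map⁺-injectiveOn f (λ x∈ y∈ → inj (there x∈) (there y∈)) xs!

sum-map-concatMap : ∀ {A B : Set} (h : B → ℕ) (f : A → List B) (xs : List A) →
  sum (map h (concatMap f xs)) ≡ sum (map (sum ∘ map h ∘ f) xs)
sum-map-concatMap h f []       = refl
sum-map-concatMap h f (x ∷ xs) = begin
  sum (map h (f x ++ concatMap f xs))              ≡⟨ cong sum (map-++ h (f x) (concatMap f xs)) ⟩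
  sum (map h (f x) ++ map h (concatMap f xs))      ≡⟨ sum-++ (map h (f x)) _ ⟩
  sum (map h (f x)) + sum (map h (concatMap f xs))
    ≡⟨ cong (sum (map h (f x)) +_) (sum-map-concatMap h f xs) ⟩
  sum (map h (f x)) + sum (map (sum ∘ map h ∘ f) xs) ∎
  where open ≡-Reasoning

sumAfter : ℕ → ℕ → (ℕ → ℕ) → ℕ
sumAfter r zero    h = 0
sumAfter r (suc c) h = h (suc r) + sumAfter (suc r) c h

sum-filter-shift : ∀ {P : ℕ → Set} (P? : Decidable P) (F : ℕ → ℕ) n →
  sum (map F (filter P? (applyUpTo suc n))) ≡ sum (map (F ∘ suc) (filter (P? ∘ suc) (upTo n)))
sum-filter-shift P? F n = cong sum (begin
  map F (filter P? (applyUpTo suc n))       ≡⟨ cong (map F ∘ filter P?) (map-upTo suc n) ⟨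
  map F (filter P? (map suc (upTo n)))      ≡⟨ cong (map F) (filter-map P? suc (upTo n)) ⟩
  map F (map suc (filter (P? ∘ suc) (upTo n))) ≡⟨ map-∘ (filter (P? ∘ suc) (upTo n)) ⟨
  map (F ∘ suc) (filter (P? ∘ suc) (upTo n)) ∎)
  where open ≡-Reasoning

sum-filter-countBelow : ∀ {P : ℕ → Set} (P? : Decidable P) (h : ℕ → ℕ) n r →
  sum (map (λ j → h (r + countBelow P? (suc j))) (filter P? (upTo n))) ≡ sumAfter r (countBelow P? n) h
sum-filter-countBelow P? h zero    r = refl
sum-filter-countBelow P? h (suc n) r with P? 0
... | yes _ = cong₂ _+_ (cong h (+-comm r 1)) (begin
  sum (map (λ j → h (r + suc (countBelow (P? ∘ suc) j))) (filter P? (applyUpTo suc n)))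
    ≡⟨ sum-filter-shift P? _ n ⟩
  sum (map (λ j → h (r + suc (countBelow (P? ∘ suc) (suc j)))) (filter (P? ∘ suc) (upTo n)))
    ≡⟨ cong sum (map-cong (λ j → cong h (+-suc r _)) (filter (P? ∘ suc) (upTo n))) ⟩
  sum (map (λ j → h (suc r + countBelow (P? ∘ suc) (suc j))) (filter (P? ∘ suc) (upTo n)))
    ≡⟨ sum-filter-countBelow (P? ∘ suc) h n (suc r) ⟩
  sumAfter (suc r) (countBelow (P? ∘ suc) n) h ∎)
  where open ≡-Reasoning
... | no _  = trans (sum-filter-shift P? _ n) (sum-filter-countBelow (P? ∘ suc) h n r)

multichoose : ℕ → ℕ → ℕ
multichoose a       zero    = 1
multichoose zero    (suc m) = 0
multichoose (suc a) (suc m) = multichoose a (suc m) + multichoose (suc a) m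

multichoose≡C : ∀ a m → multichoose a m ≡ (a + (m ∸ 1)) C m
multichoose≡C a       zero    = refl
multichoose≡C zero    (suc m) = sym (k>n⇒nCk≡0 (n<1+n m))
multichoose≡C (suc a) (suc m) = begin
  multichoose a (suc m) + multichoose (suc a) m
    ≡⟨ cong₂ _+_ (multichoose≡C a (suc m)) (multichoose≡C (suc a) m) ⟩
  (a + m) C suc m + (suc a + (m ∸ 1)) C m        ≡⟨ cong ((a + m) C suc m +_) (shifted m) ⟩
  (a + m) C suc m + (a + m) C m                  ≡⟨ +-comm ((a + m) C suc m) _ ⟩
  (a + m) C m + (a + m) C suc m                  ≡⟨ nCk+nC[k+1]≡[n+1]C[k+1] (a + m) m ⟩
  suc (a + m) C suc m                            ∎
  where
  open ≡-Reasoning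
  shifted : ∀ m → (suc a + (m ∸ 1)) C m ≡ (a + m) C m
  shifted zero    = refl
  shifted (suc m) = cong (_C suc m) (sym (+-suc a m))

-- A closed recursion for the number of depth-m descendants of a node labelled (c, k) in the
-- generating tree; treeCount-suc is the tree's own recurrence.
treeCount : ℕ → ℕ → ℕ → ℕ
treeCount zero    c k = 1
treeCount (suc m) c k = multichoose c (suc m) + treeCount m (c + suc k) (suc k)

treeCount-pascal : ∀ m c k → treeCount m (suc c) k + treeCount (suc m) c k ≡ treeCount (suc m) (suc c) k
treeCount-pascal zero    c k = +-comm 1 (multichoose c 1 + 1)
treeCount-pascal (suc m) c k = begin
  (M (suc c) (suc m) + E m (suc (c + suc k)) (suc k)) + (M c (suc (suc m)) + E (suc m) (c + suc k) (suc k))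
    ≡⟨ interchange (M (suc c) (suc m)) _ (M c (suc (suc m))) _ ⟩
  (M (suc c) (suc m) + M c (suc (suc m))) + (E m (suc (c + suc k)) (suc k) + E (suc m) (c + suc k) (suc k))
    ≡⟨ cong₂ _+_ (+-comm (M (suc c) (suc m)) _) (treeCount-pascal m (c + suc k) (suc k)) ⟩
  (M c (suc (suc m)) + M (suc c) (suc m)) + E (suc m) (suc (c + suc k)) (suc k) ∎
  where
  open ≡-Reasoning
  M : ℕ → ℕ → ℕ
  M = multichoose
  E : ℕ → ℕ → ℕ → ℕ
  E = treeCount

treeCount-sumAfter : ∀ m k c r →
  treeCount (suc m) (r + c) k ≡ treeCount (suc m) r k + sumAfter r c (λ i → treeCount m i k)
treeCount-sumAfter m k zero    r =
  trans (cong (λ x → treeCount (suc m) x k) (+-identityʳ r)) (sym (+-identityʳ _))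
treeCount-sumAfter m k (suc c) r = begin
  E (suc m) (r + suc c) k              ≡⟨ cong (λ x → E (suc m) x k) (+-suc r c) ⟩
  E (suc m) (suc r + c) k              ≡⟨ treeCount-sumAfter m k c (suc r) ⟩
  E (suc m) (suc r) k + S              ≡⟨ cong (_+ S) (treeCount-pascal m r k) ⟨
  (E m (suc r) k + E (suc m) r k) + S  ≡⟨ cong (_+ S) (+-comm (E m (suc r) k) _) ⟩
  (E (suc m) r k + E m (suc r) k) + S  ≡⟨ +-assoc (E (suc m) r k) _ S ⟩
  E (suc m) r k + (E m (suc r) k + S)  ∎
  where
  open ≡-Reasoning
  E : ℕ → ℕ → ℕ → ℕ
  E = treeCount
  S : ℕ
  S = sumAfter (suc r) c (λ i → treeCount m i k)

treeCount-suc : ∀ m c k →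
  treeCount (suc m) c k ≡ treeCount m (suc k) (suc k) + sumAfter 0 c (λ i → treeCount m i k)
treeCount-suc m c k = treeCount-sumAfter m k c 0

triangle : ℕ → ℕ
triangle k = suc k C 2

triangle-suc : ∀ k → triangle (suc k) ≡ triangle k + suc k
triangle-suc k = begin
  suc (suc k) C 2            ≡⟨ nCk+nC[k+1]≡[n+1]C[k+1] (suc k) 1 ⟨
  suc k C 1 + triangle k     ≡⟨ cong (_+ triangle k) (nC1≡n (suc k)) ⟩
  suc k + triangle k         ≡⟨ +-comm (suc k) _ ⟩
  triangle k + suc k         ∎
  where open ≡-Reasoning

treeCount-triangle : ∀ m k →
  treeCount m (triangle k) k ≡ sum (map (λ j → multichoose (triangle (k + j)) (m ∸ j)) (upTo (suc m)))
treeCount-triangle zero    k = refl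
treeCount-triangle (suc m) k =
  cong₂ _+_ (cong (λ x → multichoose (triangle x) (suc m)) (sym (+-identityʳ k))) (begin
  treeCount m (triangle k + suc k) (suc k)
    ≡⟨ cong (λ x → treeCount m x (suc k)) (triangle-suc k) ⟨
  treeCount m (triangle (suc k)) (suc k)
    ≡⟨ treeCount-triangle m (suc k) ⟩
  sum (map (λ j → M (triangle (suc k + j)) (m ∸ j)) (upTo (suc m)))
    ≡⟨ cong sum (map-cong (λ j → cong (λ x → M (triangle x) (m ∸ j)) (sym (+-suc k j))) (upTo (suc m))) ⟩
  sum (map (G ∘ suc) (upTo (suc m)))                 ≡⟨ cong sum (map-upTo (G ∘ suc) (suc m)) ⟩
  sum (applyUpTo (G ∘ suc) (suc m))                  ≡⟨ cong sum (map-applyUpTo suc G (suc m)) ⟨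
  sum (map G (applyUpTo suc (suc m)))                ∎)
  where
  open ≡-Reasoning
  M : ℕ → ℕ → ℕ
  M = multichoose
  G : ℕ → ℕ
  G j = multichoose (triangle (k + j)) (suc m ∸ j)

formula≡treeCount : ∀ n → formula n ≡ treeCount n 0 0
formula≡treeCount n = begin
  sum (map (term n) (upTo (suc n)))
    ≡⟨ cong sum (map-cong (λ j → multichoose≡C (triangle j) (n ∸ j)) (upTo (suc n))) ⟨
  sum (map (λ j → multichoose (triangle (0 + j)) (n ∸ j)) (upTo (suc n)))
    ≡⟨ treeCount-triangle n 0 ⟨
  treeCount n 0 0 ∎
  where open ≡-Reasoning

allBelow? : {P : ℕ → Set} → Decidable P → ∀ j → Dec (∀ a → a < j → P a)
allBelow? P? j = map′ (λ h a → h {a}) (λ h {a} → h a) (allUpTo? P? j)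

LeftToRightMin? : ∀ f j → Dec (LeftToRightMin f j)
LeftToRightMin? f j = allBelow? (λ a → ¬? (f a <? f j)) j

AdmissibleAfter : ℕ → (ℕ → ℕ) → ℕ → Set
AdmissibleAfter n f j = LeftToRightMin f j × MaxIsLRMinBefore n f (suc j)

AdmissibleAfter? : ∀ n f j → Dec (AdmissibleAfter n f j)
AdmissibleAfter? n f j =
  LeftToRightMin? f j ×-dec allBelow? (λ b → (suc (f b) ≟ n) →-dec LeftToRightMin? f b) (suc j)

module FrontInsertion {n f g} (I : MaxInsertion n 0 f g) where
  open MaxInsertion I

  g0-LRMin : LeftToRightMin g 0
  g0-LRMin a ()

  LRMin-suc⇔ : ∀ i → i < n → LeftToRightMin g (suc i) ⇔ LeftToRightMin f i
  LRMin-suc⇔ i i<n = mk⇔ to from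
    where
    to : LeftToRightMin g (suc i) → LeftToRightMin f i
    to h a a<i fa<fi = h (suc a) (s≤s a<i) (subst₂ _<_ (sym (after a z≤n)) (sym (after i z≤n)) fa<fi)
    from : LeftToRightMin f i → LeftToRightMin g (suc i)
    from h zero    _         g0<gi = <-asym (f<n i i<n) (subst₂ _<_ at-site (after i z≤n) g0<gi)
    from h (suc a) (s≤s a<i) ga<gi = h a a<i (subst₂ _<_ (after a z≤n) (after i z≤n) ga<gi)

  max-before-vacuous : ∀ i → i < suc n → MaxIsLRMinBefore (suc n) g (suc i)
  max-before-vacuous i i<1+n zero    _         _       = g0-LRMin
  max-before-vacuous i i<1+n (suc b) (s≤s b<i) 1+gb≡1+n =
    ⊥-elim (<-irrefl (trans (sym (after b z≤n)) (suc-injective 1+gb≡1+n))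
      (f<n b (<-≤-trans b<i (m<1+n⇒m≤n i<1+n))))

  lrMins-front : countBelow (LeftToRightMin? g) (suc n) ≡ suc (countBelow (LeftToRightMin? f) n)
  lrMins-front = cong₂ _+_ (indicator-yes (LeftToRightMin? g 0) g0-LRMin)
    (countBelow-cong (LeftToRightMin? g ∘ suc) (LeftToRightMin? f) n LRMin-suc⇔)

  admissibleSites-front :
    countBelow (AdmissibleAfter? (suc n) g) (suc n) ≡ suc (countBelow (LeftToRightMin? f) n)
  admissibleSites-front = trans
    (countBelow-cong (AdmissibleAfter? (suc n) g) (LeftToRightMin? g) (suc n)
      (λ i i<1+n → mk⇔ proj₁ (λ lrmin → lrmin , max-before-vacuous i i<1+n)))
    lrMins-front

module SiteInsertion {n j f g} (I : MaxInsertion n (suc j) f g) (adm : AdmissibleAfter n f j) where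
  open MaxInsertion I
  open MaxInsertionProperties I using (position; pos-before; pos-site; pos-after)

  ¬LRMin-site : ¬ LeftToRightMin g (suc j)
  ¬LRMin-site h = h 0 z<s (subst₂ _<_ (sym (before 0 z<s)) (sym at-site) (f<n 0 (<-≤-trans z<s q≤n)))

  LRMin-before⇔ : ∀ i → i < suc j → LeftToRightMin g i ⇔ LeftToRightMin f i
  LRMin-before⇔ i i<q = mk⇔
    (λ h a a<i fa<fi → h a a<i (subst₂ _<_ (sym (before a (<-trans a<i i<q))) (sym (before i i<q)) fa<fi))
    (λ h a a<i ga<gi → h a a<i (subst₂ _<_ (before a (<-trans a<i i<q)) (before i i<q) ga<gi))

  LRMin-after⇔ : ∀ i → suc j ≤ i → i < n → LeftToRightMin g (suc i) ⇔ LeftToRightMin f i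
  LRMin-after⇔ i q≤i i<n = mk⇔ to from
    where
    to : LeftToRightMin g (suc i) → LeftToRightMin f i
    to h a a<i fa<fi with a <? suc j
    ... | yes a<q = h a (<-trans a<i (n<1+n i)) (subst₂ _<_ (sym (before a a<q)) (sym (after i q≤i)) fa<fi)
    ... | no a≮q  =
      h (suc a) (s≤s a<i) (subst₂ _<_ (sym (after a (≮⇒≥ a≮q))) (sym (after i q≤i)) fa<fi)
    from : LeftToRightMin f i → LeftToRightMin g (suc i)
    from h a a<1+i ga<g1+i with position a (<-trans a<1+i (s≤s i<n))
    ... | pos-before a<q ga       = h a (<-≤-trans a<q q≤i) (subst₂ _<_ ga (after i q≤i) ga<g1+i)
    ... | pos-site refl           = <-asym (f<n i i<n) (subst₂ _<_ at-site (after i q≤i) ga<g1+i)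
    ... | pos-after a′ refl _ _ ga = h a′ (≤-pred a<1+i) (subst₂ _<_ ga (after i q≤i) ga<g1+i)

  lrMins-site : countBelow (LeftToRightMin? g) (suc n) ≡ countBelow (LeftToRightMin? f) n
  lrMins-site =
    countBelow-skip (LeftToRightMin? g) (LeftToRightMin? f) (suc j) n q≤n ¬LRMin-site LRMin-before⇔ LRMin-after⇔

  admissibleSites-site :
    countBelow (AdmissibleAfter? (suc n) g) (suc n) ≡ countBelow (AdmissibleAfter? n f) (suc j)
  admissibleSites-site = countBelow-prefix (AdmissibleAfter? (suc n) g) (AdmissibleAfter? n f) (suc j) (suc n)
    (≤-trans q≤n (n≤1+n n)) admissible⇔ not-admissible
    where
    admissible⇔ : ∀ i → i < suc j → AdmissibleAfter (suc n) g i ⇔ AdmissibleAfter n f i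
    admissible⇔ i i<q = mk⇔
      (λ (lrmin , _) →
        Equivalence.to (LRMin-before⇔ i i<q) lrmin , λ b b<1+i → proj₂ adm b (<-≤-trans b<1+i i<q))
      (λ (lrmin , _) → Equivalence.from (LRMin-before⇔ i i<q) lrmin , max-before-vacuous i i<q)
      where
      max-before-vacuous : ∀ i → i < suc j → MaxIsLRMinBefore (suc n) g (suc i)
      max-before-vacuous i i<q b b<1+i 1+gb≡1+n = ⊥-elim (<-irrefl (suc-injective 1+gb≡1+n)
        (subst (_< n) (sym (before b b<q)) (f<n b (<-≤-trans b<q q≤n))))
        where
        b<q : b < suc j
        b<q = <-≤-trans b<1+i i<q
    not-admissible : ∀ i → suc j ≤ i → i < suc n → ¬ AdmissibleAfter (suc n) g i
    not-admissible i q≤i _ (_ , max-before) = ¬LRMin-site (max-before (suc j) (s≤s q≤i) (cong suc at-site))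

lrMins : ∀ {n} → Vec (Fin n) n → ℕ
lrMins {n} π = countBelow (LeftToRightMin? (entry π)) n

admissibleSites : ∀ {n} → Vec (Fin n) n → ℕ
admissibleSites {n} π = countBelow (AdmissibleAfter? n (entry π)) n

sites : ∀ {n} → Vec (Fin n) n → List ℕ
sites {n} π = 0 ∷ map suc (filter (AdmissibleAfter? n (entry π)) (upTo n))

children : ∀ {n} → Vec (Fin n) n → List (Vec (Fin (suc n)) (suc n))
children π = map (λ q → insertMax q π) (sites π)

level : (n : ℕ) → List (Vec (Fin n) n)
level zero    = [] ∷ []
level (suc n) = concatMap children (level n)

∈-sites⇔ : ∀ {n} (π : Vec (Fin n) n) {q} → q ∈ sites π ⇔ (q ≤ n × Admissible n (entry π) q)
∈-sites⇔ {n} π = mk⇔ to from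
  where
  to : ∀ {q} → q ∈ sites π → q ≤ n × Admissible n (entry π) q
  to (here refl) = z≤n , inj₁ refl , λ _ ()
  to (there q∈) with ∈-map⁻ suc q∈
  ... | j , j∈ , refl with ∈-filter⁻ (AdmissibleAfter? n (entry π)) j∈
  ...   | j∈upTo , (lrmin , max-before) = ∈-upTo⁻ j∈upTo , inj₂ (j , refl , lrmin) , max-before
  from : ∀ {q} → q ≤ n × Admissible n (entry π) q → q ∈ sites π
  from (_   , inj₁ refl , _) = here refl
  from (q≤n , inj₂ (j , refl , lrmin) , max-before) =
    there (∈-map⁺ suc (∈-filter⁺ (AdmissibleAfter? n (entry π)) (∈-upTo⁺ q≤n) (lrmin , max-before)))

∈-level⇔ : ∀ n (σ : Vec (Fin n) n) →
  σ ∈ level n ⇔ (InjectiveBelow n (entry σ) × AvoidsPR n (entry σ))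
∈-level⇔ n σ = mk⇔ (to n σ) (from n σ)
  where
  to : ∀ n (σ : Vec (Fin n) n) → σ ∈ level n → InjectiveBelow n (entry σ) × AvoidsPR n (entry σ)
  to zero    [] _  = (λ _ _ ()) , (λ _ _ _ ()) , (λ _ _ _ _ _ ())
  to (suc n) σ σ∈ with find (∈-concatMap⁻ children σ∈)
  ... | π , π∈ , σ∈children with ∈-map⁻ (λ q → insertMax q π) σ∈children
  ...   | q , q∈ , refl with to n π π∈ | Equivalence.to (∈-sites⇔ π) q∈
  ...     | injective , avoids | q≤n , adm =
    Equivalence.from InjectiveBelow-insert⇔ injective , Equivalence.from AvoidsPR-insert⇔ (avoids , adm)
    where open MaxInsertionProperties (insertMax-MaxInsertion π q≤n)
  from : ∀ n (σ : Vec (Fin n) n) → InjectiveBelow n (entry σ) × AvoidsPR n (entry σ) → σ ∈ level n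
  from zero    [] _ = here refl
  from (suc n) σ (injective , avoids)
    with q , q≤n , π , refl ←
      insertMax-surjective σ (Equivalence.from (IsPerm⇔InjectiveBelow σ) injective) =
    ∈-concatMap⁺ children (lose π∈ (∈-map⁺ (λ q → insertMax q π) q∈))
    where
    open MaxInsertionProperties (insertMax-MaxInsertion π q≤n)
    π-avoids×adm : AvoidsPR n (entry π) × Admissible n (entry π) q
    π-avoids×adm = Equivalence.to AvoidsPR-insert⇔ avoids
    π∈ : π ∈ level n
    π∈ = from n π (Equivalence.to InjectiveBelow-insert⇔ injective , proj₁ π-avoids×adm)
    q∈ : q ∈ sites π
    q∈ = Equivalence.from (∈-sites⇔ π) (q≤n , proj₂ π-avoids×adm)

sites-bounded : ∀ {n} (π : Vec (Fin n) n) {q} → q ∈ sites π → q ≤ n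
sites-bounded π = proj₁ ∘ Equivalence.to (∈-sites⇔ π)

sites-unique : ∀ {n} (π : Vec (Fin n) n) → Unique (sites π)
sites-unique {n} π = All.map⁺ (All.universal (λ _ ()) _)
  ∷ Uniqueₚ.map⁺ suc-injective (Uniqueₚ.filter⁺ (AdmissibleAfter? n (entry π)) (Uniqueₚ.upTo⁺ n))

children-unique : ∀ {n} (π : Vec (Fin n) n) → Unique (children π)
children-unique π = map⁺-injectiveOn (λ q → insertMax q π)
  (λ q∈ r∈ → proj₁ ∘ insertMax-injective π π (sites-bounded π q∈) (sites-bounded π r∈))
  (sites-unique π)

children-disjoint : ∀ {n} {π σ : Vec (Fin n) n} → π ≢ σ → Disjoint (children π) (children σ)
children-disjoint {π = π} {σ} π≢σ (τ∈π , τ∈σ)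
  with q , q∈ , refl ← ∈-map⁻ (λ q → insertMax q π) τ∈π
     | r , r∈ , eq   ← ∈-map⁻ (λ q → insertMax q σ) τ∈σ =
  π≢σ (proj₂ (insertMax-injective π σ (sites-bounded π q∈) (sites-bounded σ r∈) eq))

level-unique : ∀ n → Unique (level n)
level-unique zero    = All.[] ∷ []
level-unique (suc n) = Uniqueₚ.concat⁺ (All.map⁺ (All.universal children-unique (level n)))
  (AllPairs.map⁺ (AllPairs.map children-disjoint (level-unique n)))

descendants : ∀ {n} → ℕ → Vec (Fin n) n → ℕ
descendants m π = treeCount m (admissibleSites π) (lrMins π)

children-descendants : ∀ {n} m (π : Vec (Fin n) n) →
  sum (map (descendants m) (children π)) ≡ descendants (suc m) π
children-descendants {n} m π = begin
  descendants m (insertMax 0 π) + sum (map (descendants m) (map (λ q → insertMax q π) (map suc admissible)))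
    ≡⟨ cong₂ _+_ front (cong sum (trans (sym (map-∘ (map suc admissible))) (sym (map-∘ admissible)))) ⟩
  treeCount m (suc k) (suc k) + sum (map (λ j → descendants m (insertMax (suc j) π)) admissible)
    ≡⟨ cong ((treeCount m (suc k) (suc k) +_) ∘ sum) (map-cong-local (All.tabulate site)) ⟩
  treeCount m (suc k) (suc k) + sum (map (λ j → h (0 + countBelow A? (suc j))) admissible)
    ≡⟨ cong (treeCount m (suc k) (suc k) +_) (sum-filter-countBelow A? h n 0) ⟩
  treeCount m (suc k) (suc k) + sumAfter 0 (admissibleSites π) h
    ≡⟨ treeCount-suc m (admissibleSites π) k ⟨
  descendants (suc m) π ∎
  where
  open ≡-Reasoning
  k : ℕ
  k = lrMins π
  A? : Decidable (AdmissibleAfter n (entry π))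
  A? = AdmissibleAfter? n (entry π)
  admissible : List ℕ
  admissible = filter A? (upTo n)
  h : ℕ → ℕ
  h i = treeCount m i k
  front : descendants m (insertMax 0 π) ≡ treeCount m (suc k) (suc k)
  front = cong₂ (treeCount m) admissibleSites-front lrMins-front
    where open FrontInsertion (insertMax-MaxInsertion π z≤n)
  site : ∀ {j} → j ∈ admissible → descendants m (insertMax (suc j) π) ≡ h (0 + countBelow A? (suc j))
  site j∈ with j∈upTo , adm ← ∈-filter⁻ A? j∈ = cong₂ (treeCount m) admissibleSites-site lrMins-site
    where open SiteInsertion (insertMax-MaxInsertion π (∈-upTo⁻ j∈upTo)) adm

level-descendants : ∀ n m → sum (map (descendants m) (level n)) ≡ treeCount (m + n) 0 0
level-descendants zero    m = trans (+-identityʳ _) (cong (λ x → treeCount x 0 0) (sym (+-identityʳ m)))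
level-descendants (suc n) m = begin
  sum (map (descendants m) (concatMap children (level n)))
    ≡⟨ sum-map-concatMap (descendants m) children (level n) ⟩
  sum (map (sum ∘ map (descendants m) ∘ children) (level n))
    ≡⟨ cong sum (map-cong (children-descendants m) (level n)) ⟩
  sum (map (descendants (suc m)) (level n))   ≡⟨ level-descendants n (suc m) ⟩
  treeCount (suc m + n) 0 0                   ≡⟨ cong (λ x → treeCount x 0 0) (+-suc m n) ⟨
  treeCount (m + suc n) 0 0                   ∎
  where open ≡-Reasoning

length≡sum-descendants₀ : ∀ {n} (xs : List (Vec (Fin n) n)) → length xs ≡ sum (map (descendants 0) xs)
length≡sum-descendants₀ []       = refl
length≡sum-descendants₀ (_ ∷ xs) = cong suc (length≡sum-descendants₀ xs)

proposition14 : (n : ℕ) → HasCard {Vec (Fin n) n} (InAv₂ pP rP) (formula n)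
proposition14 n = level n , level-unique n , ∈-level⇔InAv₂ , length-level
  where
  ∈-level⇔InAv₂ : ∀ σ → σ ∈ level n ⇔ InAv₂ pP rP σ
  ∈-level⇔InAv₂ σ =
    ⇔-sym (IsPerm⇔InjectiveBelow σ ×-⇔ Avoids-pP⇔AvoidsP σ ×-⇔ Avoids-rP⇔AvoidsR σ) ⇔-∘ ∈-level⇔ n σ
  length-level : length (level n) ≡ formula n
  length-level = begin
    length (level n)                     ≡⟨ length≡sum-descendants₀ (level n) ⟩
    sum (map (descendants 0) (level n))  ≡⟨ level-descendants n 0 ⟩
    treeCount n 0 0                      ≡⟨ formula≡treeCount n ⟨
    formula n                            ∎
    where open ≡-Reasoning
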